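{- Let $G$ be a map on an orientable surface and $\hat G$ its primal-dual completion. An orientation of $\hat G$ is a Schnyder orientation if and only if every closed walk $W$ of the dual map $\hat G^*$ satisfies $\delta(W)\equiv 0 \pmod 3$.
   Context: A map is a graph embedded on an orientable surface with all faces open disks and no contractible cycles of length 1 or 2. An angle labeling of $G$ maps angles (face corners) to $\mathbb{Z}_3$; an edge is of type 0 if its four incident angles have equal labels, of type 1 or 2 if in clockwise order they read $i-1,i,i,i+1$ (type 1: the two $i$'s at the same extremity; type 2: on the same side); EDGE means every edge has type 0, 1 or 2. The primal-dual completion $\hat G$ is obtained by embedding $G$ and $G^*$ together, each edge crossing its dual once, crossing points becoming edge-vertices (degree 4); other vertices are primal- or dual-vertices; every edge of $\hat G$ joins an edge-vertex to a primal- or dual-vertex; faces of $\hat G$ correspond to angles of $G$. A Schnyder orientation of $\hat G$ is an orientation for which there is an EDGE angle labeling $\ell$ of $G$ such that each edge of $\hat G$ separating faces (angles) $a,a'$ is oriented away from its edge-vertex if $\ell(a)=\ell(a')$ and towards it otherwise. Out-edges are the edges of $\hat G$ oriented from a primal- or dual-vertex to an edge-vertex. For a walk $W$ of $\hat G^*$, $\delta(W)$ is, summed over the traversals of $W$, the number of out-edges crossing $W$ from left to right minus the number crossing $W$ from right to left. -}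

module Defs where

open import Data.Nat using (ℕ; zero; suc)
open import Data.Fin using (Fin)
import Data.Fin as F
open import Data.Bool using (Bool; true; false)
open import Data.Integer using (ℤ; +_; -_) renaming (_+_ to _+ℤ_)
open import Data.List using (List; []; _∷_; _++_; head; last)
open import Data.Maybe using (Maybe; just; nothing)
open import Data.Product using (Σ; ∃; ∃-syntax; _×_; _,_)
open import Data.Sum using (_⊎_)
open import Data.Unit using (⊤)
open import Relation.Nullary using (¬_)
open import Relation.Binary.PropositionalEquality using (_≡_; _≢_)
open import Relation.Binary.Construct.Closure.Equivalence using (EqClosure)

iter : {A : Set} → (A → A) → ℕ → A → A
iter f zero    x = x
iter f (suc k) x = f (iter f k x)

-- Maps on orientable surfaces, as combinatorial maps (rotation systems).
-- Darts are Fin nD; α is the fixed-point-free involution pairing the two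
-- darts of an edge; σ is the COUNTERCLOCKWISE rotation of darts around
-- their vertex (this fixes the orientation of the surface); σ⁻ is its
-- inverse.  Vertices are σ-orbits, edges are α-orbits, faces are orbits
-- of φ = σ⁻ ∘ α (face traversed with the face on the left).  Every face
-- of such a map is an open disk and the surface is orientable.
-- The angle (corner) "d" is the wedge at the vertex of d going
-- counterclockwise from d to σ d; so angles are in bijection with darts.

Adj : {D : Set} → (D → D) → (D → D) → D → D → Set
Adj α σ x y = (y ≡ α x) ⊎ (y ≡ σ x)

record Map : Set where
  field
    nD       : ℕ
    α        : Fin nD → Fin nD
    σ        : Fin nD → Fin nD
    σ⁻       : Fin nD → Fin nD
    α-invol  : ∀ d → α (α d) ≡ d
    α-nofix  : ∀ d → α d ≢ d
    σ⁻-σ     : ∀ d → σ⁻ (σ d) ≡ d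
    σ-σ⁻     : ∀ d → σ (σ⁻ d) ≡ d
    connected : ∀ d d' → EqClosure (Adj α σ) d d'

module MapNotions (M : Map) where
  open Map M

  Dart : Set
  Dart = Fin nD

  -- face permutation: next dart along the face lying to the left of d
  φ : Dart → Dart
  φ d = σ⁻ (α d)

  SameVertex : Dart → Dart → Set
  SameVertex d d' = ∃[ k ] (iter σ k d ≡ d')

  -- Walks of G are lists of darts (each dart goes from its own vertex to
  -- the vertex of its opposite dart α d).  Homotopy of closed walks on
  -- the surface is generated by inserting/removing a backtrack d, α d and
  -- inserting/removing the boundary walk of a face, at a position whose
  -- vertex matches.

  -- "the vertex between p and q in the walk p ++ q is the vertex of x"
  Junction : List Dart → List Dart → Dart → Set
  Junction p q x =
    (∀ d → last p ≡ just d → SameVertex (α d) x) ×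
    (p ≡ [] → ∀ d → head q ≡ just d → SameVertex d x)

  faceWalk : Dart → ℕ → List Dart
  faceWalk d zero    = []
  faceWalk d (suc n) = d ∷ faceWalk (φ d) n

  data ElemHom : List Dart → List Dart → Set where
    backtrack : ∀ p q d → Junction p q d →
                ElemHom (p ++ q) (p ++ (d ∷ α d ∷ q))
    face      : ∀ p q d k → iter φ (suc k) d ≡ d → Junction p q d →
                ElemHom (p ++ q) (p ++ (faceWalk d (suc k) ++ q))

  Contractible : List Dart → Set
  Contractible w = EqClosure ElemHom w []

  -- cycles of length 1 (loops) and 2 (two distinct parallel edges
  -- between two distinct vertices)
  Cycle1 : Dart → Set
  Cycle1 d = SameVertex (α d) d

  Cycle2 : Dart → Dart → Set
  Cycle2 d₁ d₂ = SameVertex (α d₁) d₂ × SameVertex (α d₂) d₁ ×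
                 ¬ SameVertex d₁ (α d₁) × d₂ ≢ d₁ × d₂ ≢ α d₁

  NoContractible12 : Set
  NoContractible12 =
    (∀ d → Cycle1 d → ¬ Contractible (d ∷ [])) ×
    (∀ d₁ d₂ → Cycle2 d₁ d₂ → ¬ Contractible (d₁ ∷ d₂ ∷ []))

  Z3 : Set
  Z3 = Fin 3

  inc : Z3 → Z3
  inc F.zero = F.suc F.zero
  inc (F.suc F.zero) = F.suc (F.suc F.zero)
  inc (F.suc (F.suc F.zero)) = F.zero

  dec : Z3 → Z3
  dec F.zero = F.suc (F.suc F.zero)
  dec (F.suc F.zero) = F.zero
  dec (F.suc (F.suc F.zero)) = F.suc F.zero

  Labeling : Set
  Labeling = Dart → Z3

  -- the four angles incident to the edge {d , α d}, in CLOCKWISE order: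
  --   σ⁻ d , d , σ⁻ (α d) , α d
  -- (σ⁻ d and d are at the vertex of d, σ⁻ (α d) and α d at the other end)

  Pat : Z3 → Z3 → Z3 → Z3 → Set
  Pat w x y z = (y ≡ x) × (w ≡ dec x) × (z ≡ inc x)

  EdgeOK : Z3 → Z3 → Z3 → Z3 → Set
  EdgeOK a b c e = ((a ≡ b) × (b ≡ c) × (c ≡ e))
                 ⊎ Pat a b c e ⊎ Pat b c e a ⊎ Pat c e a b ⊎ Pat e a b c

  EDGE : Labeling → Set
  EDGE ℓ = ∀ d → EdgeOK (ℓ (σ⁻ d)) (ℓ d) (ℓ (σ⁻ (α d))) (ℓ (α d))

  -- The primal-dual completion Ĝ.
  -- Its edges are indexed by HKind × Dart:
  --   (prim , d): primal half-edge from the vertex of d to the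
  --               edge-vertex of {d , α d}; separates angles σ⁻ d and d;
  --   (dual , d): dual half-edge from the face-vertex of the face on the
  --               left of d to the edge-vertex of {d , α d}; separates
  --               angles d and σ⁻ (α d).
  -- Faces of Ĝ = angles of G = darts.
  data HKind : Set where
    prim dual : HKind

  -- the two angles separated by an edge of Ĝ; oriented so that crossing
  -- from sideL to sideR, the edge pointing from its primal/dual vertex
  -- to its edge-vertex crosses the crossing path from left to right.
  sideL : HKind → Dart → Dart
  sideL prim d = σ⁻ d
  sideL dual d = d

  sideR : HKind → Dart → Dart
  sideR prim d = d
  sideR dual d = σ⁻ (α d)

  -- an orientation of Ĝ: for each edge, true iff it is oriented from its
  -- primal/dual vertex towards its edge-vertex (i.e. it is an out-edge)
  Orientation : Set
  Orientation = HKind → Dart → Bool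

  IsSchnyder : Orientation → Set
  IsSchnyder o = Σ Labeling λ ℓ → EDGE ℓ ×
    (∀ k d → (o k d ≡ false → ℓ (sideL k d) ≡ ℓ (sideR k d)) ×
             (o k d ≡ true  → ℓ (sideL k d) ≢ ℓ (sideR k d)))

  -- Walks of the dual map Ĝ* (vertices = angles = darts, edges = dual to
  -- the edges of Ĝ).  Each step traverses an edge of Ĝ* either forwards
  -- (from sideL to sideR) or backwards.
  data DWalk : Dart → Dart → Set where
    []   : ∀ {a} → DWalk a a
    fwd  : ∀ {b} k d → DWalk (sideR k d) b → DWalk (sideL k d) b
    bwd  : ∀ {b} k d → DWalk (sideL k d) b → DWalk (sideR k d) b

  outVal : Bool → ℤ
  outVal true  = + 1
  outVal false = + 0

  -- δ(W): out-edges crossing W from left to right minus those crossing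
  -- from right to left
  δ : Orientation → ∀ {a b} → DWalk a b → ℤ
  δ o []          = + 0
  δ o (fwd k d W) = outVal (o k d) +ℤ δ o W
  δ o (bwd k d W) = (- outVal (o k d)) +ℤ δ o W

module Submission where

open import Defs
open import Data.Integer using (+_)
open import Data.Integer.Divisibility using (_∣_)
open import Function.Bundles using (_⇔_)

open import Algebra.Bundles using (AbelianGroup)
import Algebra.Properties.AbelianGroup as AbelianGroupProperties
import Algebra.Properties.CommutativeSemigroup as CommutativeSemigroupProperties
open import Data.Bool using (Bool; true; false)
open import Data.Empty using (⊥-elim)
open import Data.Fin using (Fin; zero; suc)
open import Data.Integer using (ℤ; -_; _-_; -[1+_]) renaming (_+_ to _+ℤ_)
open import Data.Integer.Properties using (+-identityʳ)
import Data.Integer.Divisibility.Signed as Signed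
open import Data.Integer.Tactic.RingSolver using (solve-∀)
open import Data.Nat using (ℕ; s≤s)
open import Data.Nat.Divisibility using (∣⇒≤)
open import Data.Product using (∃; _×_; _,_)
open import Data.Sum using (inj₁; inj₂)
open import Function.Bundles using (Equivalence; mk⇔)
open import Function.Properties.Equivalence using () renaming (trans to ⇔-trans)
open import Level using (0ℓ)
open import Relation.Binary.Construct.Closure.Equivalence using (EqClosure)
open import Relation.Binary.Construct.Closure.ReflexiveTransitive using (ε; _◅_)
open import Relation.Binary.Construct.Closure.Symmetric using (SymClosure; fwd; bwd)
open import Relation.Binary.PropositionalEquality

-- Write bit(o,e) ∈ ℤ₃ for 1 if the edge e of Ĝ is an out-edge
-- and 0 otherwise.  An angle labeling ℓ is a *potential* of a ℤ₃-weighting w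
-- of the edges of Ĝ* if crossing any edge forwards adds its weight to ℓ.
--
--  (1) o is Schnyder  ⇔  bit(o,·) has a potential.  On an EDGE labeling the
--      label can only stay or grow by 1 across an edge of Ĝ, so the Schnyder
--      rule says exactly that ℓ is a potential; conversely around each
--      edge-vertex a potential returns to its start, and the four-label
--      patterns compatible with such a return are exactly the EDGE patterns.
--  (2) A ℤ₃-weighting has a potential  ⇔  it sums to 0 along every closed
--      walk of Ĝ*.  This is the usual "exact 1-cochain" argument, using that
--      Ĝ* is connected (the map is): integrate from a base angle.
--  (3) The ℤ₃-sum of bit(o,·) along a walk is δ(W) reduced mod 3.

-- A base point: all elements of Fin n determine the same element, so a base
-- angle is available without assuming that the map has darts.
firstOf : ∀ {n} → Fin n → Fin n
firstOf {ℕ.suc n} _ = zero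

firstOf-const : ∀ {n} (x y : Fin n) → firstOf x ≡ firstOf y
firstOf-const {ℕ.suc n} _ _ = refl

module Lemma19 (M : Map) where
  open Map M
  open MapNotions M

  -- ℤ₃ as an abelian group: addition is iterated inc, so the group laws
  -- reduce to inc³ = id; the derived group facts are taken from the library.
  infixl 6 _⊕_
  _⊕_ : Z3 → Z3 → Z3
  zero ⊕ y = y
  suc zero ⊕ y = inc y
  suc (suc zero) ⊕ y = inc (inc y)

  ⊖_ : Z3 → Z3
  ⊖ zero = zero
  ⊖ suc zero = suc (suc zero)
  ⊖ suc (suc zero) = suc zero

  inc³ : ∀ x → inc (inc (inc x)) ≡ x
  inc³ zero = refl
  inc³ (suc zero) = refl
  inc³ (suc (suc zero)) = refl

  dec≡inc² : ∀ x → dec x ≡ inc (inc x)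
  dec≡inc² zero = refl
  dec≡inc² (suc zero) = refl
  dec≡inc² (suc (suc zero)) = refl

  inc-⊕ : ∀ x y → inc x ⊕ y ≡ inc (x ⊕ y)
  inc-⊕ zero y = refl
  inc-⊕ (suc zero) y = refl
  inc-⊕ (suc (suc zero)) y = sym (inc³ y)

  ⊕-assoc : ∀ x y z → (x ⊕ y) ⊕ z ≡ x ⊕ (y ⊕ z)
  ⊕-assoc zero y z = refl
  ⊕-assoc (suc zero) y z = inc-⊕ y z
  ⊕-assoc (suc (suc zero)) y z = trans (inc-⊕ (inc y) z) (cong inc (inc-⊕ y z))

  ⊕-identityʳ : ∀ x → x ⊕ zero ≡ x
  ⊕-identityʳ zero = refl
  ⊕-identityʳ (suc zero) = refl
  ⊕-identityʳ (suc (suc zero)) = refl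

  ⊕-comm : ∀ x y → x ⊕ y ≡ y ⊕ x
  ⊕-comm zero y = sym (⊕-identityʳ y)
  ⊕-comm (suc zero) zero = refl
  ⊕-comm (suc zero) (suc zero) = refl
  ⊕-comm (suc zero) (suc (suc zero)) = refl
  ⊕-comm (suc (suc zero)) zero = refl
  ⊕-comm (suc (suc zero)) (suc zero) = refl
  ⊕-comm (suc (suc zero)) (suc (suc zero)) = refl

  ⊖-inverseˡ : ∀ x → ⊖ x ⊕ x ≡ zero
  ⊖-inverseˡ zero = refl
  ⊖-inverseˡ (suc zero) = refl
  ⊖-inverseˡ (suc (suc zero)) = refl

  ℤ₃ : AbelianGroup 0ℓ 0ℓ
  ℤ₃ = record
    { Carrier = Z3 ; _≈_ = _≡_ ; _∙_ = _⊕_ ; ε = zero ; _⁻¹ = ⊖_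
    ; isAbelianGroup = record
      { isGroup = record
        { isMonoid = record
          { isSemigroup = record
            { isMagma = record { isEquivalence = isEquivalence ; ∙-cong = cong₂ _⊕_ }
            ; assoc = ⊕-assoc }
          ; identity = (λ _ → refl) , ⊕-identityʳ }
        ; inverse = ⊖-inverseˡ , (λ x → trans (⊕-comm x (⊖ x)) (⊖-inverseˡ x))
        ; ⁻¹-cong = cong ⊖_ }
      ; comm = ⊕-comm } }

  open AbelianGroupProperties ℤ₃ using (∙-cancelʳ; identityˡ-unique; y≈x\\z)
  open CommutativeSemigroupProperties (AbelianGroup.commutativeSemigroup ℤ₃)
    using (x∙yz≈yx∙z)

  inc-fixfree : ∀ x → inc x ≢ x
  inc-fixfree zero ()
  inc-fixfree (suc zero) ()
  inc-fixfree (suc (suc zero)) ()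

  inc²-fixfree : ∀ x → inc (inc x) ≢ x
  inc²-fixfree zero ()
  inc²-fixfree (suc zero) ()
  inc²-fixfree (suc (suc zero)) ()

  bit : Bool → Z3
  bit false = zero
  bit true = suc zero

  emb : Z3 → ℤ
  emb zero = + 0
  emb (suc zero) = + 1
  emb (suc (suc zero)) = + 2

  record Residue (X : ℤ) (u : Z3) : Set where
    constructor residue
    field 3∣X-u : + 3 Signed.∣ X - emb u

  carry : ∀ u v → + 3 Signed.∣ (emb u +ℤ emb v) - emb (u ⊕ v)
  carry zero zero = Signed.divides (+ 0) refl
  carry zero (suc zero) = Signed.divides (+ 0) refl
  carry zero (suc (suc zero)) = Signed.divides (+ 0) refl
  carry (suc zero) zero = Signed.divides (+ 0) refl
  carry (suc zero) (suc zero) = Signed.divides (+ 0) refl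
  carry (suc zero) (suc (suc zero)) = Signed.divides (+ 1) refl
  carry (suc (suc zero)) zero = Signed.divides (+ 0) refl
  carry (suc (suc zero)) (suc zero) = Signed.divides (+ 1) refl
  carry (suc (suc zero)) (suc (suc zero)) = Signed.divides (+ 1) refl

  residue-+ : ∀ {X Y u v} → Residue X u → Residue Y v → Residue (X +ℤ Y) (u ⊕ v)
  residue-+ {X} {Y} {u} {v} (residue rX) (residue rY) = residue (
    subst (+ 3 Signed.∣_) (sym (regroup X Y (emb u) (emb v) (emb (u ⊕ v))))
      (Signed.∣m∣n⇒∣m+n (Signed.∣m∣n⇒∣m+n rX rY) (carry u v)))
    where
    regroup : ∀ X Y a b c → (X +ℤ Y) - c ≡ ((X - a) +ℤ (Y - b)) +ℤ ((a +ℤ b) - c)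
    regroup = solve-∀

  residue-out : ∀ b → Residue (outVal b) (bit b)
  residue-out false = residue (Signed.divides (+ 0) refl)
  residue-out true = residue (Signed.divides (+ 0) refl)

  residue-negOut : ∀ b → Residue (- outVal b) (⊖ bit b)
  residue-negOut false = residue (Signed.divides (+ 0) refl)
  residue-negOut true = residue (Signed.divides -[1+ 0 ] refl)

  residue-divisible : ∀ {X u} → Residue X u → (+ 3 ∣ X ⇔ u ≡ zero)
  residue-divisible {X} {u} (residue rX) = mk⇔ (divisible⇒zero u rX) zero⇒divisible
    where
    zero⇒divisible : u ≡ zero → + 3 ∣ X
    zero⇒divisible refl = Signed.∣⇒∣ᵤ (subst (+ 3 Signed.∣_) (+-identityʳ X) rX)
    divisible⇒zero : ∀ u → + 3 Signed.∣ X - emb u → + 3 ∣ X → u ≡ zero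
    divisible⇒zero zero _ _ = refl
    divisible⇒zero (suc zero) rX 3∣X
      with ∣⇒≤ (Signed.∣⇒∣ᵤ (Signed.∣m+n∣m⇒∣n {m = X} {n = - + 1} rX (Signed.∣ᵤ⇒∣ 3∣X)))
    ... | s≤s ()
    divisible⇒zero (suc (suc zero)) rX 3∣X
      with ∣⇒≤ (Signed.∣⇒∣ᵤ (Signed.∣m+n∣m⇒∣n {m = X} {n = - + 2} rX (Signed.∣ᵤ⇒∣ 3∣X)))
    ... | s≤s (s≤s ())

  EdgeOK-rotate : ∀ {a b c e} → EdgeOK a b c e → EdgeOK b c e a
  EdgeOK-rotate (inj₁ (a≡b , b≡c , c≡e)) = inj₁ (b≡c , c≡e , sym (trans a≡b (trans b≡c c≡e)))
  EdgeOK-rotate (inj₂ (inj₁ p)) = inj₂ (inj₂ (inj₂ (inj₂ p)))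
  EdgeOK-rotate (inj₂ (inj₂ (inj₁ p))) = inj₂ (inj₁ p)
  EdgeOK-rotate (inj₂ (inj₂ (inj₂ (inj₁ p)))) = inj₂ (inj₂ (inj₁ p))
  EdgeOK-rotate (inj₂ (inj₂ (inj₂ (inj₂ p)))) = inj₂ (inj₂ (inj₂ (inj₁ p)))

  EdgeOK-increment : ∀ {a b c e} → EdgeOK a b c e → a ≢ b → b ≡ inc a
  EdgeOK-increment (inj₁ (a≡b , _)) a≢b = ⊥-elim (a≢b a≡b)
  EdgeOK-increment {b = b} (inj₂ (inj₁ (_ , refl , _))) _ =
    trans (sym (inc³ b)) (cong inc (sym (dec≡inc² b)))
  EdgeOK-increment {c = c} (inj₂ (inj₂ (inj₁ (_ , refl , refl)))) _ = dec≡inc² c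
  EdgeOK-increment (inj₂ (inj₂ (inj₂ (inj₁ (refl , _ , refl))))) _ = refl
  EdgeOK-increment (inj₂ (inj₂ (inj₂ (inj₂ (b≡a , _))))) a≢b = ⊥-elim (a≢b (sym b≡a))

  pattern-of-increments : ∀ {w x y z} → x ≡ inc w → y ≡ x → z ≡ inc y → Pat w x y z
  pattern-of-increments {w} refl refl refl =
    refl , trans (sym (inc³ w)) (sym (dec≡inc² (inc w))) , refl

  -- Going around the four angles with increments bit bᵢ and returning to
  -- the start forces an EDGE quadruple: either no increment or exactly three.
  EdgeOK-closing : ∀ b₁ b₂ b₃ b₄ {a b c e} →
    b ≡ bit b₁ ⊕ a → c ≡ bit b₂ ⊕ b → e ≡ bit b₃ ⊕ c → a ≡ bit b₄ ⊕ e →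
    EdgeOK a b c e
  EdgeOK-closing false false false false p q r s = inj₁ (sym p , sym q , sym r)
  EdgeOK-closing false true true true p q r s =
    inj₂ (inj₂ (inj₂ (inj₂ (pattern-of-increments s p q))))
  EdgeOK-closing true false true true p q r s = inj₂ (inj₁ (pattern-of-increments p q r))
  EdgeOK-closing true true false true p q r s =
    inj₂ (inj₂ (inj₁ (pattern-of-increments q r s)))
  EdgeOK-closing true true true false p q r s =
    inj₂ (inj₂ (inj₂ (inj₁ (pattern-of-increments r s p))))
  EdgeOK-closing true false false false refl refl refl s = ⊥-elim (inc-fixfree _ (sym s))
  EdgeOK-closing false true false false refl refl refl s = ⊥-elim (inc-fixfree _ (sym s))
  EdgeOK-closing false false true false refl refl refl s = ⊥-elim (inc-fixfree _ (sym s))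
  EdgeOK-closing false false false true refl refl refl s = ⊥-elim (inc-fixfree _ (sym s))
  EdgeOK-closing true true false false refl refl refl s = ⊥-elim (inc²-fixfree _ (sym s))
  EdgeOK-closing true false true false refl refl refl s = ⊥-elim (inc²-fixfree _ (sym s))
  EdgeOK-closing true false false true refl refl refl s = ⊥-elim (inc²-fixfree _ (sym s))
  EdgeOK-closing false true true false refl refl refl s = ⊥-elim (inc²-fixfree _ (sym s))
  EdgeOK-closing false true false true refl refl refl s = ⊥-elim (inc²-fixfree _ (sym s))
  EdgeOK-closing false false true true refl refl refl s = ⊥-elim (inc²-fixfree _ (sym s))
  EdgeOK-closing true true true true {a} refl refl refl s =
    ⊥-elim (inc-fixfree a (sym (trans s (inc³ (inc a)))))

  Rule : Bool → Z3 → Z3 → Set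
  Rule b x y = (b ≡ false → x ≡ y) × (b ≡ true → x ≢ y)

  increment⇒rule : ∀ b {x y} → y ≡ bit b ⊕ x → Rule b x y
  increment⇒rule false y≡x = (λ _ → sym y≡x) , λ ()
  increment⇒rule true {x} y≡incx = (λ ()) , λ _ x≡y → inc-fixfree x (trans (sym y≡incx) (sym x≡y))

  rule⇒increment : ∀ b {x y} → Rule b x y → (x ≢ y → y ≡ inc x) → y ≡ bit b ⊕ x
  rule⇒increment false (same , _) _ = sym (same refl)
  rule⇒increment true (_ , differ) grow = grow (differ refl)

  infixr 5 _++ʷ_
  _++ʷ_ : ∀ {a b c} → DWalk a b → DWalk b c → DWalk a c
  [] ++ʷ W₂ = W₂
  fwd k d W₁ ++ʷ W₂ = fwd k d (W₁ ++ʷ W₂)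
  bwd k d W₁ ++ʷ W₂ = bwd k d (W₁ ++ʷ W₂)

  Weight : Set
  Weight = HKind → Dart → Z3

  total : Weight → ∀ {a b} → DWalk a b → Z3
  total w [] = zero
  total w (fwd k d W) = w k d ⊕ total w W
  total w (bwd k d W) = ⊖ w k d ⊕ total w W

  total-++ : ∀ w {a b c} (W₁ : DWalk a b) (W₂ : DWalk b c) →
    total w (W₁ ++ʷ W₂) ≡ total w W₁ ⊕ total w W₂
  total-++ w [] W₂ = refl
  total-++ w (fwd k d W₁) W₂ =
    trans (cong (w k d ⊕_) (total-++ w W₁ W₂)) (sym (⊕-assoc (w k d) _ _))
  total-++ w (bwd k d W₁) W₂ =
    trans (cong (⊖ w k d ⊕_) (total-++ w W₁ W₂)) (sym (⊕-assoc (⊖ w k d) _ _))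

  IsPotential : Weight → Labeling → Set
  IsPotential w ℓ = ∀ k d → ℓ (sideR k d) ≡ w k d ⊕ ℓ (sideL k d)

  -- A potential changes along a walk by the weight of the walk; a backward
  -- crossing is handled by solving the potential equation for the left label.
  potential-along : ∀ {w ℓ} → IsPotential w ℓ → ∀ {a b} (W : DWalk a b) →
    ℓ b ≡ total w W ⊕ ℓ a
  potential-along P [] = refl
  potential-along {w} {ℓ} P (fwd k d W) =
    trans (potential-along P W)
      (trans (cong (total w W ⊕_) (P k d)) (x∙yz≈yx∙z (total w W) (w k d) (ℓ (sideL k d))))
  potential-along {w} {ℓ} P (bwd k d W) =
    trans (potential-along P W)
      (trans (cong (total w W ⊕_) (y≈x\\z (w k d) (ℓ (sideL k d)) (ℓ (sideR k d)) (sym (P k d))))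
        (x∙yz≈yx∙z (total w W) (⊖ w k d) (ℓ (sideR k d))))

  -- Ĝ* is connected: one can walk from a dart to α d and to σ d and back.
  toα : ∀ x → DWalk x (α x)
  toα x = fwd dual x (fwd prim (α x) [])

  toσ : ∀ x → DWalk x (σ x)
  toσ x = subst (λ y → DWalk y (σ x)) (σ⁻-σ x) (fwd prim (σ x) [])

  fromα : ∀ x → DWalk (α x) x
  fromα x = subst (DWalk (α x)) (α-invol x) (toα (α x))

  fromσ : ∀ x → DWalk (σ x) x
  fromσ x = subst (DWalk (σ x)) (σ⁻-σ x) (bwd prim (σ x) [])

  adjacency-walk : ∀ {x y} → SymClosure (Adj α σ) x y → DWalk x y
  adjacency-walk (fwd (inj₁ refl)) = toα _
  adjacency-walk (fwd (inj₂ refl)) = toσ _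
  adjacency-walk (bwd (inj₁ refl)) = fromα _
  adjacency-walk (bwd (inj₂ refl)) = fromσ _

  closure-walk : ∀ {x y} → EqClosure (Adj α σ) x y → DWalk x y
  closure-walk ε = []
  closure-walk (s ◅ ss) = adjacency-walk s ++ʷ closure-walk ss

  connect : ∀ x y → DWalk x y
  connect x y = closure-walk (connected x y)

  ClosedWalksVanish : Weight → Set
  ClosedWalksVanish w = ∀ a (W : DWalk a a) → total w W ≡ zero

  path-independent : ∀ {w} → ClosedWalksVanish w → ∀ {a b} (W W′ : DWalk a b) →
    total w W ≡ total w W′
  path-independent {w} vanish {a} {b} W W′ =
    ∙-cancelʳ (total w back) _ _ (begin
      total w W ⊕ total w back   ≡⟨ sym (total-++ w W back) ⟩
      total w (W ++ʷ back)       ≡⟨ vanish a (W ++ʷ back) ⟩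
      zero                       ≡⟨ sym (vanish a (W′ ++ʷ back)) ⟩
      total w (W′ ++ʷ back)      ≡⟨ total-++ w W′ back ⟩
      total w W′ ⊕ total w back  ∎)
    where
    open ≡-Reasoning
    back : DWalk b a
    back = connect b a

  potential⇔vanish : ∀ w → (∃ λ ℓ → IsPotential w ℓ) ⇔ ClosedWalksVanish w
  potential⇔vanish w = mk⇔ vanish potential
    where
    vanish : (∃ λ ℓ → IsPotential w ℓ) → ClosedWalksVanish w
    vanish (ℓ , P) a W = identityˡ-unique (total w W) (ℓ a) (sym (potential-along P W))

    potential : ClosedWalksVanish w → ∃ λ ℓ → IsPotential w ℓ
    potential closed = ℓ , crossing
      where
      open ≡-Reasoning
      ℓ : Labeling
      ℓ x = total w (connect (firstOf x) x)

      crossing : IsPotential w ℓ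
      crossing k d = begin
        total w (connect (firstOf R) R)
          ≡⟨ cong (λ base → total w (connect base R)) (firstOf-const R L) ⟩
        total w (connect (firstOf L) R)
          ≡⟨ path-independent closed (connect (firstOf L) R) (connect (firstOf L) L ++ʷ fwd k d []) ⟩
        total w (connect (firstOf L) L ++ʷ fwd k d [])
          ≡⟨ total-++ w (connect (firstOf L) L) (fwd k d []) ⟩
        ℓ L ⊕ (w k d ⊕ zero)
          ≡⟨ cong (ℓ L ⊕_) (⊕-identityʳ (w k d)) ⟩
        ℓ L ⊕ w k d
          ≡⟨ ⊕-comm (ℓ L) (w k d) ⟩
        w k d ⊕ ℓ L ∎
        where
        L R : Dart
        L = sideL k d
        R = sideR k d

  outWeight : Orientation → Weight
  outWeight o k d = bit (o k d)

  schnyder⇔potential : ∀ o → IsSchnyder o ⇔ (∃ λ ℓ → IsPotential (outWeight o) ℓ)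
  schnyder⇔potential o = mk⇔ potential schnyder
    where
    potential : IsSchnyder o → ∃ λ ℓ → IsPotential (outWeight o) ℓ
    potential (ℓ , edge , rule) = ℓ , λ k d → rule⇒increment (o k d) (rule k d) (grows k d)
      where
      grows : ∀ k d → ℓ (sideL k d) ≢ ℓ (sideR k d) → ℓ (sideR k d) ≡ inc (ℓ (sideL k d))
      grows prim d = EdgeOK-increment (edge d)
      grows dual d = EdgeOK-increment (EdgeOK-rotate (edge d))

    schnyder : (∃ λ ℓ → IsPotential (outWeight o) ℓ) → IsSchnyder o
    schnyder (ℓ , P) = ℓ , edge , λ k d → increment⇒rule (o k d) (P k d)
      where
      edge : EDGE ℓ
      edge d = EdgeOK-closing (o prim d) (o dual d) (o prim (α d)) (o dual (α d))
        (P prim d) (P dual d) (P prim (α d))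
        (subst (λ x → ℓ (σ⁻ x) ≡ outWeight o dual (α d) ⊕ ℓ (α d)) (α-invol d) (P dual (α d)))

  δ-residue : ∀ o {a b} (W : DWalk a b) → Residue (δ o W) (total (outWeight o) W)
  δ-residue o [] = residue (Signed.divides (+ 0) refl)
  δ-residue o (fwd k d W) = residue-+ (residue-out (o k d)) (δ-residue o W)
  δ-residue o (bwd k d W) = residue-+ (residue-negOut (o k d)) (δ-residue o W)

  vanish⇔divisible : ∀ o →
    ClosedWalksVanish (outWeight o) ⇔ (∀ a (W : DWalk a a) → + 3 ∣ δ o W)
  vanish⇔divisible o = mk⇔
    (λ vanish a W → Equivalence.from (residue-divisible (δ-residue o W)) (vanish a W))
    (λ divisible a W → Equivalence.to (residue-divisible (δ-residue o W)) (divisible a W))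

-- Chain (1), (2) and (3); the absence of contractible 1- and 2-cycles is unused.
lemma19 : (M : Map) → MapNotions.NoContractible12 M →
    (o : MapNotions.Orientation M) →
    MapNotions.IsSchnyder M o ⇔
      (∀ a (W : MapNotions.DWalk M a a) → (+ 3) ∣ MapNotions.δ M o W)
lemma19 M _ o =
  ⇔-trans (schnyder⇔potential o)
    (⇔-trans (potential⇔vanish (outWeight o)) (vanish⇔divisible o))
  where open Lemma19 M
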